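{- Let $(G,k,(V_1,\dots,V_k))$ be an instance of \textsc{Multicolored Clique}, and let $G'$, $S=V\cup X\cup U$, $T=V\cup Y\cup U$ and $\ell=8\binom{k}{2}+2k$ be as constructed in the context. If there is a sequence of at most $\ell$ token slides transforming $S$ into $T$ in $G'$, then $(G,k,(V_1,\dots,V_k))$ is a yes-instance of \textsc{Multicolored Clique}.
   Context: \textsc{Multicolored Clique}: given $G$ with vertex set $V$ partitioned into $V_1,\dots,V_k$ (no edges inside a class), decide whether $G$ has a clique with one vertex in each class. Construction: $m=\binom{k}{2}$. Take $V$; for each edge $e=\{u,v\}$ of $G$ add a vertex $v_e$ adjacent to $u,v$. $\mathcal{E}_{ij}$ = set of $v_e$ with $e$ between $V_i$ and $V_j$ ($i\ne j$, unordered); label the $m$ sets $\mathcal{E}_{ij}$ bijectively by $1,\dots,m$. Add independent sets $X=\{x_1,\dots,x_m\}$, $Y=\{y_1,\dots,y_m\}$; for each $b$ and each $v_e$ in the set labeled $b$, join $x_b$ to $v_e$ and $y_b$ to $v_e$ each by a path with three new internal vertices. $U_1$ (resp. $U_2$) is the set of middle internal vertices of the paths from $X$ (resp. $Y$); $U=U_1\cup U_2$. For each $v\in V$ add a vertex $z_v$ adjacent only to $v$. A token slide transforms an independent set $I$ into $(I\setminus\{u\})\cup\{w\}$ where $u\in I$, $w\notin I$, $\{u,w\}\in E(G')$, and the result is independent. -}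

module Defs where

open import Data.Nat using (ℕ; zero; suc; _+_; _*_)
open import Data.Nat.Combinatorics using (_C_)
open import Data.Fin using (Fin; _<_; _<?_)
open import Data.Bool using (Bool; true; false)
open import Data.Product using (Σ; _×_; _,_; ∃; ∃-syntax)
open import Data.Sum using (_⊎_; inj₁; inj₂)
open import Relation.Nullary using (¬_; Dec; yes; no)
open import Relation.Nullary.Decidable using (⌊_⌋; _×-dec_)
open import Relation.Binary.PropositionalEquality using (_≡_; _≢_)
open import Function.Bundles using (_⇔_)

record SimpleGraph (n : ℕ) : Set₁ where
  field
    _~_    : Fin n → Fin n → Set
    ~-sym  : ∀ {u v} → u ~ v → v ~ u
    ~-irr  : ∀ {u} → ¬ (u ~ u)
    ~-dec  : ∀ u v → Dec (u ~ v)
open SimpleGraph public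

-- (G, k, (V_1..V_k)) : the partition is given by a colouring c : Fin n → Fin k,
-- V_i = c⁻¹(i). No edges inside a class:
NoEdgeInsideClass : ∀ {n k} → SimpleGraph n → (Fin n → Fin k) → Set
NoEdgeInsideClass G c = ∀ {u v} → _~_ G u v → c u ≢ c v

MulticoloredClique : ∀ {n k} → SimpleGraph n → (Fin n → Fin k) → Set
MulticoloredClique {n} {k} G c =
  Σ (Fin k → Fin n) λ f → (∀ i → c (f i) ≡ i) × (∀ i j → i ≢ j → _~_ G (f i) (f j))

m : ℕ → ℕ
m k = k C 2

-- A bijective labelling of the unordered pairs {i,j} (i ≠ j) of classes by Fin m.
-- lab i j is the label of the set ℰ_ij; its value for i = j is irrelevant.
IsPairLabelling : ∀ {k} → (Fin k → Fin k → Fin (m k)) → Set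
IsPairLabelling {k} lab =
  (∀ i j → lab i j ≡ lab j i) ×
  (∀ i j i' j' → i ≢ j → i' ≢ j' → lab i j ≡ lab i' j' →
      (i ≡ i' × j ≡ j') ⊎ (i ≡ j' × j ≡ i')) ×
  (∀ b → ∃[ i ] ∃[ j ] (i ≢ j × lab i j ≡ b))

ℓ : ℕ → ℕ
ℓ k = 8 * m k + 2 * k

module Construction {n k : ℕ} (G : SimpleGraph n) (c : Fin n → Fin k)
                    (lab : Fin k → Fin k → Fin (m k)) where

  -- an edge e = {u,v} of G is represented by the pair (u,v) with u < v
  Edge : Fin n → Fin n → Set
  Edge u v = (u < v) × _~_ G u v

  edge? : ∀ u v → Dec (Edge u v)
  edge? u v = (u <? v) ×-dec ~-dec G u v

  -- vertices of G'.  ev u v is v_e for e = {u,v}; px₀/px₁/px₂ u v are the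
  -- internal vertices (in order from x_b towards v_e) of the path joining
  -- x_b to v_e, and similarly py₀/py₁/py₂ for y_b.  Constructors applied to
  -- pairs (u,v) which are not edges with u < v give isolated junk vertices.
  data V' : Set where
    orig        : Fin n → V'
    ev          : Fin n → Fin n → V'
    xv yv       : Fin (m k) → V'
    px₀ px₁ px₂ : Fin n → Fin n → V'
    py₀ py₁ py₂ : Fin n → Fin n → V'
    zv          : Fin n → V'

  data Arc : V' → V' → Set where
    u-e  : ∀ {u v} → Edge u v → Arc (orig u) (ev u v)
    v-e  : ∀ {u v} → Edge u v → Arc (orig v) (ev u v)
    x-p₀ : ∀ {u v b} → Edge u v → lab (c u) (c v) ≡ b → Arc (xv b) (px₀ u v)
    xp₀₁ : ∀ {u v} → Edge u v → Arc (px₀ u v) (px₁ u v)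
    xp₁₂ : ∀ {u v} → Edge u v → Arc (px₁ u v) (px₂ u v)
    xp₂e : ∀ {u v} → Edge u v → Arc (px₂ u v) (ev u v)
    y-p₀ : ∀ {u v b} → Edge u v → lab (c u) (c v) ≡ b → Arc (yv b) (py₀ u v)
    yp₀₁ : ∀ {u v} → Edge u v → Arc (py₀ u v) (py₁ u v)
    yp₁₂ : ∀ {u v} → Edge u v → Arc (py₁ u v) (py₂ u v)
    yp₂e : ∀ {u v} → Edge u v → Arc (py₂ u v) (ev u v)
    v-z  : ∀ {v} → Arc (orig v) (zv v)

  Adj : V' → V' → Set
  Adj a b = Arc a b ⊎ Arc b a

  VSet : Set
  VSet = V' → Bool

  Independent : VSet → Set
  Independent I = ∀ a b → I a ≡ true → I b ≡ true → ¬ Adj a b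

  Slide : VSet → VSet → Set
  Slide I J = Σ V' λ u → Σ V' λ w →
    I u ≡ true × I w ≡ false × Adj u w ×
    (∀ x → (J x ≡ true) ⇔ ((I x ≡ true × x ≢ u) ⊎ x ≡ w)) ×
    Independent J

  data Slides : ℕ → VSet → VSet → Set where
    done : ∀ {I J} → (∀ x → I x ≡ J x) → Slides zero I J
    step : ∀ {t I J K} → Slide I J → Slides t J K → Slides (suc t) I K

  -- S = V ∪ X ∪ U and T = V ∪ Y ∪ U  (U₁ = middles px₁, U₂ = middles py₁)
  S : VSet
  S (orig _)   = true
  S (xv _)     = true
  S (px₁ u v)  = ⌊ edge? u v ⌋
  S (py₁ u v)  = ⌊ edge? u v ⌋
  S _          = false

  T : VSet
  T (orig _)   = true
  T (yv _)     = true
  T (px₁ u v)  = ⌊ edge? u v ⌋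
  T (py₁ u v)  = ⌊ edge? u v ⌋
  T _          = false

-- Weigh every token by its height: along each path pair x_b, …, v_e, …, y_b the heights run
-- 0, …, 8 (v_e at height 4), and all other vertices sit at height 4.  Passing from S to T
-- raises the total height by 8m, while one slide raises it by at most one and, if it does,
-- touches no vertex of G.  Hence the slides touch V at most 2k times in all, so at most k
-- vertices of G are touched twice.  On the other hand, for every label b some token enters
-- the y-side of b, and it can only do so from a vertex v_e with e of label b, at a moment when
-- both ends of e are empty; those ends belong to S and T, so each of them is touched twice.
-- Thus a set of at most k vertices contains an edge between every two classes, which forces
-- a multicoloured clique.
module Submission where

open import Defs
open import Data.Bool using (Bool; true; false; if_then_else_)
open import Data.Bool.Properties using (¬-not)
open import Data.Fin using (Fin; zero; suc; _≟_)
open import Data.Fin.Patterns using (0F; 1F; 2F; 3F; 4F; 5F; 6F)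
open import Data.Fin.Properties using (+↔⊎; *↔×)
open import Data.Maybe using (Maybe; just; nothing; maybe′)
open import Data.Nat using (ℕ; zero; suc; _+_; _*_; _∸_; _≤_; _<_; z≤n; s≤s; _≤?_)
open import Data.Nat.Properties hiding (_≟_)
open import Data.Product using (∃-syntax; _×_; _,_; proj₁; proj₂)
open import Data.Product.Function.NonDependent.Propositional using (_×-↔_)
open import Data.Sum using (_⊎_; inj₁; inj₂)
open import Data.Sum.Function.Propositional using (_⊎-↔_)
open import Function using (_∘_; case_of_; _↔_; _⇔_; mk⇔; mk↔ₛ′; Inverse; Equivalence)
open import Function.Properties.Inverse using (↔-refl; ↔-sym; ↔-trans; ↔⇒↣)
open import Relation.Binary using (DecidableEquality)
open import Relation.Binary.PropositionalEquality
open import Relation.Nullary using (¬_; Dec; does; yes; no; contradiction)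
open import Relation.Nullary.Decidable using (via-injection)
open import Relation.Unary using (Pred; Decidable)
open import Algebra.Properties.Semiring.Sum +-*-semiring
  using (sum; sum-syntax; ∑-distrib-+; ∑-comm; *-distribˡ-sum; *-distribʳ-sum; sum-cong-≗; sum-replicate-zero)
open import Algebra.Properties.CommutativeSemigroup +-commutativeSemigroup using (interchange)

indicator : ∀ {p} {P : Set p} → Dec P → ℕ
indicator d = if does d then 1 else 0

indicator-yes : ∀ {p} {P : Set p} (d : Dec P) → P → indicator d ≡ 1
indicator-yes (yes _) _ = refl
indicator-yes (no ¬p) p = contradiction p ¬p

indicator-no : ∀ {p} {P : Set p} (d : Dec P) → ¬ P → indicator d ≡ 0
indicator-no (yes p) ¬p = contradiction p ¬p
indicator-no (no _) _ = refl

indicator-⇔ : ∀ {p q} {P : Set p} {Q : Set q} → P ⇔ Q → (d : Dec P) (e : Dec Q) → indicator d ≡ indicator e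
indicator-⇔ P⇔Q d (yes q) = indicator-yes d (Equivalence.from P⇔Q q)
indicator-⇔ P⇔Q d (no ¬q) = indicator-no d (¬q ∘ Equivalence.to P⇔Q)

δ : ∀ {n} → Fin n → Fin n → ℕ
δ i j = indicator (i ≟ j)

δ-refl : ∀ {n} (i : Fin n) → δ i i ≡ 1
δ-refl i = indicator-yes (i ≟ i) refl

∑-const : ∀ n x → ∑[ i < n ] x ≡ n * x
∑-const zero x = refl
∑-const (suc n) x = cong (x +_) (∑-const n x)

∑-mono-≤ : ∀ {n} {f g : Fin n → ℕ} → (∀ i → f i ≤ g i) → ∑[ i < n ] f i ≤ ∑[ i < n ] g i
∑-mono-≤ {zero} _ = z≤n
∑-mono-≤ {suc n} f≤g = +-mono-≤ (f≤g zero) (∑-mono-≤ (f≤g ∘ suc))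

∑-δ : ∀ {n} (j : Fin n) → ∑[ i < n ] δ i j ≡ 1
∑-δ {suc n} zero = cong suc (sum-replicate-zero n)
∑-δ {suc n} (suc j) = ∑-δ j

term≤∑ : ∀ {n} (f : Fin n → ℕ) j → f j ≤ ∑[ i < n ] f i
term≤∑ f zero = m≤m+n _ _
term≤∑ f (suc j) = ≤-trans (term≤∑ (f ∘ suc) j) (m≤n+m _ _)

two-terms≤∑ : ∀ {n} (f : Fin n → ℕ) {j j'} → j ≢ j' → f j + f j' ≤ ∑[ i < n ] f i
two-terms≤∑ f {zero} {zero} j≢j' = contradiction refl j≢j'
two-terms≤∑ f {zero} {suc j'} _ = +-monoʳ-≤ (f zero) (term≤∑ (f ∘ suc) j')
two-terms≤∑ f {suc j} {zero} _ =
  ≤-trans (≤-reflexive (+-comm (f (suc j)) (f zero))) (+-monoʳ-≤ (f zero) (term≤∑ (f ∘ suc) j))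
two-terms≤∑ f {suc j} {suc j'} j≢j' =
  ≤-trans (two-terms≤∑ (f ∘ suc) (j≢j' ∘ cong suc)) (m≤n+m _ _)

markov : ∀ {n} c (f : Fin n → ℕ) → c * ∑[ i < n ] indicator (c ≤? f i) ≤ ∑[ i < n ] f i
markov {n} c f = begin
  c * ∑[ i < n ] indicator (c ≤? f i)   ≡⟨ *-distribˡ-sum {n} c _ ⟩
  ∑[ i < n ] (c * indicator (c ≤? f i)) ≤⟨ ∑-mono-≤ (λ i → bound (f i) (c ≤? f i)) ⟩
  ∑[ i < n ] f i                        ∎
  where
  open ≤-Reasoning
  bound : ∀ x (d : Dec (c ≤ x)) → c * indicator d ≤ x
  bound x (yes c≤x) = ≤-trans (≤-reflexive (*-identityʳ c)) c≤x
  bound x (no _) = ≤-trans (≤-reflexive (*-zeroʳ c)) z≤n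

∑-fibres : ∀ {n k} (c : Fin n → Fin k) (f : Fin n → ℕ) →
           ∑[ u < n ] f u ≡ ∑[ i < k ] ∑[ u < n ] (δ i (c u) * f u)
∑-fibres {n} {k} c f = begin
  ∑[ u < n ] f u
    ≡⟨ sum-cong-≗ (λ u → trans (cong (_* f u) (∑-δ (c u))) (+-identityʳ (f u))) ⟨
  ∑[ u < n ] ((∑[ i < k ] δ i (c u)) * f u)
    ≡⟨ sum-cong-≗ (λ u → *-distribʳ-sum (f u) (λ i → δ i (c u))) ⟩
  ∑[ u < n ] ∑[ i < k ] (δ i (c u) * f u)
    ≡⟨ ∑-comm (λ u i → δ i (c u) * f u) ⟩
  ∑[ i < k ] ∑[ u < n ] (δ i (c u) * f u) ∎
  where open ≡-Reasoning

at-most-one-per-class : ∀ {n k p} {P : Pred (Fin n) p} (P? : Decidable P) (c : Fin n → Fin k) →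
  ∑[ u < n ] indicator (P? u) ≤ k → (∀ i → ∃[ u ] P u × c u ≡ i) →
  ∀ {u u'} → P u → P u' → c u ≡ c u' → u ≡ u'
at-most-one-per-class {n} {k} {P = P} P? c few meets {u} {u'} Pu Pu' cu≡cu' with u ≟ u'
... | yes u≡u' = u≡u'
... | no u≢u' = contradiction few (<⇒≱ (begin-strict
  k
    <⟨ n<1+n k ⟩
  suc k
    ≡⟨ trans (cong₂ _+_ (trans (∑-const k 1) (*-identityʳ k)) (∑-δ (c u))) (+-comm k 1) ⟨
  ∑[ i < k ] 1 + ∑[ i < k ] δ i (c u)
    ≡⟨ ∑-distrib-+ (λ _ → 1) (λ i → δ i (c u)) ⟨
  ∑[ i < k ] (1 + δ i (c u))
    ≤⟨ ∑-mono-≤ fibre-lower-bound ⟩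
  ∑[ i < k ] fibre i
    ≡⟨ ∑-fibres c (indicator ∘ P?) ⟨
  ∑[ v < n ] indicator (P? v) ∎))
  where
  open ≤-Reasoning
  term : Fin k → Fin n → ℕ
  term i v = δ i (c v) * indicator (P? v)
  fibre : Fin k → ℕ
  fibre i = ∑[ v < n ] term i v
  term-one : ∀ {i v} → P v → c v ≡ i → term i v ≡ 1
  term-one {v = v} Pv refl = cong₂ _*_ (δ-refl (c v)) (indicator-yes (P? v) Pv)
  fibre-lower-bound : ∀ i → 1 + δ i (c u) ≤ fibre i
  fibre-lower-bound i with i ≟ c u
  ... | yes refl = ≤-trans (≤-reflexive (sym (cong₂ _+_ (term-one Pu refl) (term-one Pu' (sym cu≡cu')))))
                           (two-terms≤∑ (term i) u≢u')
  ... | no _ with meets i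
  ...   | w , Pw , cw≡i = ≤-trans (≤-reflexive (sym (term-one Pw cw≡i))) (term≤∑ (term i) w)

module _ {n k} (G : SimpleGraph n) (c : Fin n → Fin k) (lab : Fin k → Fin k → Fin (m k))
         (no-edge-inside : NoEdgeInsideClass G c) (labelling : IsPairLabelling lab) where

  module _ {p} {P : Pred (Fin n) p}
           (edges : ∀ b → ∃[ u ] ∃[ v ] _~_ G u v × lab (c u) (c v) ≡ b × P u × P v) where

    edge-between : ∀ {i j} → i ≢ j → ∃[ u ] ∃[ v ] _~_ G u v × P u × P v × c u ≡ i × c v ≡ j
    edge-between {i} {j} i≢j with edges (lab i j)
    ... | u , v , uv , lab≡ , Pu , Pv
        with proj₁ (proj₂ labelling) (c u) (c v) i j (no-edge-inside uv) i≢j lab≡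
    ...   | inj₁ (cu≡i , cv≡j) = u , v , uv , Pu , Pv , cu≡i , cv≡j
    ...   | inj₂ (cu≡j , cv≡i) = v , u , ~-sym G uv , Pv , Pu , cv≡i , cu≡j

    -- lab i i is a junk label, but being realised by two distinct classes it shows that k ≥ 2.
    another-class : ∀ i → ∃[ j ] i ≢ j
    another-class i with proj₂ (proj₂ labelling) (lab i i)
    ... | i' , j' , i'≢j' , _ with i ≟ i'
    ...   | yes refl = j' , i'≢j'
    ...   | no i≢i' = i' , i≢i'

    every-class-meets : ∀ i → ∃[ u ] P u × c u ≡ i
    every-class-meets i with edge-between (proj₂ (another-class i))
    ... | u , _ , _ , Pu , _ , cu≡i , _ = u , Pu , cu≡i

    multicolored-clique : (P? : Decidable P) → ∑[ u < n ] indicator (P? u) ≤ k → MulticoloredClique G c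
    multicolored-clique P? few = representative , class-of-representative , adjacent
      where
      representative : Fin k → Fin n
      representative i = proj₁ (every-class-meets i)
      class-of-representative : ∀ i → c (representative i) ≡ i
      class-of-representative i = proj₂ (proj₂ (every-class-meets i))
      is-representative : ∀ {u i} → P u → c u ≡ i → u ≡ representative i
      is-representative {i = i} Pu cu≡i =
        at-most-one-per-class P? c few every-class-meets Pu (proj₁ (proj₂ (every-class-meets i)))
          (trans cu≡i (sym (class-of-representative i)))
      adjacent : ∀ i j → i ≢ j → _~_ G (representative i) (representative j)
      adjacent i j i≢j with edge-between i≢j
      ... | u , v , uv , Pu , Pv , cu≡i , cv≡j =
            subst₂ (_~_ G) (is-representative Pu cu≡i) (is-representative Pv cv≡j) uv

module FiniteSum {A : Set} {N : ℕ} (A↔Fin : A ↔ Fin N) where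
  open Inverse A↔Fin using (to; from; strictlyInverseˡ; strictlyInverseʳ)

  infix 4 _≟ᴬ_
  _≟ᴬ_ : DecidableEquality A
  _≟ᴬ_ = via-injection (↔⇒↣ A↔Fin) _≟_

  ∑ᴬ : (A → ℕ) → ℕ
  ∑ᴬ f = ∑[ i < N ] f (from i)

  ∑ᴬ-cong : ∀ {f g : A → ℕ} → (∀ a → f a ≡ g a) → ∑ᴬ f ≡ ∑ᴬ g
  ∑ᴬ-cong f≗g = sum-cong-≗ (f≗g ∘ from)

  ∑ᴬ-δ : ∀ x → ∑ᴬ (λ a → indicator (a ≟ᴬ x)) ≡ 1
  ∑ᴬ-δ x =
    trans (sum-cong-≗ (λ i → indicator-⇔ (from≡⇔≡to i) (from i ≟ᴬ x) (i ≟ to x))) (∑-δ (to x))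
    where
    from≡⇔≡to : ∀ i → from i ≡ x ⇔ i ≡ to x
    from≡⇔≡to i = mk⇔ (λ e → trans (sym (strictlyInverseˡ i)) (cong to e))
                      (λ e → trans (cong from e) (strictlyInverseʳ x))

  ∑ᴬ-pick : ∀ x (g : A → ℕ) → ∑ᴬ (λ a → indicator (a ≟ᴬ x) * g a) ≡ g x
  ∑ᴬ-pick x g = begin
    ∑ᴬ (λ a → indicator (a ≟ᴬ x) * g a)   ≡⟨ ∑ᴬ-cong (λ a → pointwise (a ≟ᴬ x)) ⟩
    ∑ᴬ (λ a → indicator (a ≟ᴬ x) * g x)   ≡⟨ *-distribʳ-sum (g x) (λ i → indicator (from i ≟ᴬ x)) ⟨
    ∑ᴬ (λ a → indicator (a ≟ᴬ x)) * g x   ≡⟨ cong (_* g x) (∑ᴬ-δ x) ⟩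
    1 * g x                               ≡⟨ *-identityˡ (g x) ⟩
    g x                                   ∎
    where
    open ≡-Reasoning
    pointwise : ∀ {a} (a≟x : Dec (a ≡ x)) → indicator a≟x * g a ≡ indicator a≟x * g x
    pointwise (yes refl) = refl
    pointwise (no _) = refl

  TokenMove : (A → Bool) → A → A → (A → Bool) → Set
  TokenMove I u v J = I u ≡ true × I v ≡ false × (∀ x → (J x ≡ true) ⇔ ((I x ≡ true × x ≢ u) ⊎ x ≡ v))

  module Move {I J : A → Bool} {u v : A} (move : TokenMove I u v J) where
    private
      Iu = proj₁ move
      Iv = proj₁ (proj₂ move)
      characterisation = proj₂ (proj₂ move)

    arrived : ∀ {x} → I x ≡ false → J x ≡ true → x ≡ v
    arrived Ix Jx with Equivalence.to (characterisation _) Jx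
    ... | inj₁ (Ix′ , _) = contradiction (trans (sym Ix′) Ix) λ ()
    ... | inj₂ x≡v = x≡v

    departed : ∀ {x} → I x ≡ true → J x ≡ false → x ≡ u
    departed {x} Ix Jx with x ≟ᴬ u
    ... | yes x≡u = x≡u
    ... | no x≢u =
          contradiction (trans (sym Jx) (Equivalence.from (characterisation x) (inj₁ (Ix , x≢u)))) λ ()

    source≢target : u ≢ v
    source≢target refl = contradiction (trans (sym Iu) Iv) λ ()

    target-filled : J v ≡ true
    target-filled = Equivalence.from (characterisation v) (inj₂ refl)

    source-emptied : J u ≡ false
    source-emptied = ¬-not λ Ju → case Equivalence.to (characterisation u) Ju of λ where
      (inj₁ (_ , u≢u)) → u≢u refl
      (inj₂ u≡v) → source≢target u≡v

    unchanged : ∀ {x} → x ≢ u → x ≢ v → J x ≡ I x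
    unchanged {x} x≢u x≢v with I x in Ix
    ... | true = Equivalence.from (characterisation x) (inj₁ (Ix , x≢u))
    ... | false = ¬-not (x≢v ∘ arrived Ix)

  weight-on : (A → ℕ) → (A → Bool) → A → ℕ
  weight-on w I a = if I a then w a else 0

  weight : (A → ℕ) → (A → Bool) → ℕ
  weight w I = ∑ᴬ (weight-on w I)

  weight-cong : ∀ w {I J : A → Bool} → (∀ x → I x ≡ J x) → weight w I ≡ weight w J
  weight-cong w I≗J = ∑ᴬ-cong (λ a → cong (λ b → if b then w a else 0) (I≗J a))

  weight-move : ∀ w {I J u v} → TokenMove I u v J → weight w J + w u ≡ weight w I + w v
  weight-move w {I} {J} {u} {v} move = begin
    weight w J + w u
      ≡⟨ cong (weight w J +_) (∑ᴬ-pick u w) ⟨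
    weight w J + ∑ᴬ (λ a → indicator (a ≟ᴬ u) * w a)
      ≡⟨ ∑-distrib-+ (weight-on w J ∘ from) _ ⟨
    ∑ᴬ (λ a → weight-on w J a + indicator (a ≟ᴬ u) * w a)
      ≡⟨ ∑ᴬ-cong (λ a → pointwise (a ≟ᴬ u) (a ≟ᴬ v)) ⟩
    ∑ᴬ (λ a → weight-on w I a + indicator (a ≟ᴬ v) * w a)
      ≡⟨ ∑-distrib-+ (weight-on w I ∘ from) _ ⟩
    weight w I + ∑ᴬ (λ a → indicator (a ≟ᴬ v) * w a)
      ≡⟨ cong (weight w I +_) (∑ᴬ-pick v w) ⟩
    weight w I + w v ∎
    where
    open ≡-Reasoning
    open Move move
    pointwise : ∀ {a} (a≟u : Dec (a ≡ u)) (a≟v : Dec (a ≡ v)) →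
                weight-on w J a + indicator a≟u * w a ≡ weight-on w I a + indicator a≟v * w a
    pointwise (yes refl) (yes a≡v) = contradiction a≡v source≢target
    pointwise (yes refl) (no _) rewrite source-emptied | proj₁ move = refl
    pointwise (no _) (yes refl) rewrite target-filled | proj₁ (proj₂ move) = refl
    pointwise (no a≢u) (no a≢v) rewrite unchanged a≢u a≢v = refl

  weight-move-≤ : ∀ w {I J u v} → TokenMove I u v J → weight w J ≤ weight w I + (w v ∸ w u)
  weight-move-≤ w {I} {J} {u} {v} move = +-cancelʳ-≤ (w u) _ _ (begin
    weight w J + w u                   ≡⟨ weight-move w move ⟩
    weight w I + w v                   ≤⟨ +-monoʳ-≤ (weight w I) (m≤n+m∸n (w v) (w u)) ⟩
    weight w I + (w u + (w v ∸ w u))   ≡⟨ cong (weight w I +_) (+-comm (w u) _) ⟩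
    weight w I + ((w v ∸ w u) + w u)   ≡⟨ +-assoc (weight w I) _ (w u) ⟨
    weight w I + (w v ∸ w u) + w u     ∎)
    where open ≤-Reasoning

  weight-move-downhill : ∀ w {I J u v} → TokenMove I u v J → w v ≤ w u → weight w J ≤ weight w I
  weight-move-downhill w {I} move v≤u = ≤-trans (weight-move-≤ w move)
    (≤-reflexive (trans (cong (weight w I +_) (m≤n⇒m∸n≡0 v≤u)) (+-identityʳ (weight w I))))

module Reconfiguration {n k : ℕ} (G : SimpleGraph n) (c : Fin n → Fin k)
                       (lab : Fin k → Fin k → Fin (m k)) where
  open Construction G c lab

  private
    M = m k

  Code : Set
  Code = Fin n ⊎ Fin n ⊎ Fin M ⊎ Fin M ⊎ Fin 7 × Fin n × Fin n

  encode : V' → Code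
  encode (orig u)  = inj₁ u
  encode (zv u)    = inj₂ (inj₁ u)
  encode (xv b)    = inj₂ (inj₂ (inj₁ b))
  encode (yv b)    = inj₂ (inj₂ (inj₂ (inj₁ b)))
  encode (ev u v)  = inj₂ (inj₂ (inj₂ (inj₂ (0F , u , v))))
  encode (px₀ u v) = inj₂ (inj₂ (inj₂ (inj₂ (1F , u , v))))
  encode (px₁ u v) = inj₂ (inj₂ (inj₂ (inj₂ (2F , u , v))))
  encode (px₂ u v) = inj₂ (inj₂ (inj₂ (inj₂ (3F , u , v))))
  encode (py₀ u v) = inj₂ (inj₂ (inj₂ (inj₂ (4F , u , v))))
  encode (py₁ u v) = inj₂ (inj₂ (inj₂ (inj₂ (5F , u , v))))
  encode (py₂ u v) = inj₂ (inj₂ (inj₂ (inj₂ (6F , u , v))))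

  decode : Code → V'
  decode (inj₁ u)                               = orig u
  decode (inj₂ (inj₁ u))                        = zv u
  decode (inj₂ (inj₂ (inj₁ b)))                 = xv b
  decode (inj₂ (inj₂ (inj₂ (inj₁ b))))          = yv b
  decode (inj₂ (inj₂ (inj₂ (inj₂ (0F , u , v))))) = ev u v
  decode (inj₂ (inj₂ (inj₂ (inj₂ (1F , u , v))))) = px₀ u v
  decode (inj₂ (inj₂ (inj₂ (inj₂ (2F , u , v))))) = px₁ u v
  decode (inj₂ (inj₂ (inj₂ (inj₂ (3F , u , v))))) = px₂ u v
  decode (inj₂ (inj₂ (inj₂ (inj₂ (4F , u , v))))) = py₀ u v
  decode (inj₂ (inj₂ (inj₂ (inj₂ (5F , u , v))))) = py₁ u v
  decode (inj₂ (inj₂ (inj₂ (inj₂ (6F , u , v))))) = py₂ u v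

  encode-decode : ∀ x → encode (decode x) ≡ x
  encode-decode (inj₁ _)                               = refl
  encode-decode (inj₂ (inj₁ _))                        = refl
  encode-decode (inj₂ (inj₂ (inj₁ _)))                 = refl
  encode-decode (inj₂ (inj₂ (inj₂ (inj₁ _))))          = refl
  encode-decode (inj₂ (inj₂ (inj₂ (inj₂ (0F , _ , _))))) = refl
  encode-decode (inj₂ (inj₂ (inj₂ (inj₂ (1F , _ , _))))) = refl
  encode-decode (inj₂ (inj₂ (inj₂ (inj₂ (2F , _ , _))))) = refl
  encode-decode (inj₂ (inj₂ (inj₂ (inj₂ (3F , _ , _))))) = refl
  encode-decode (inj₂ (inj₂ (inj₂ (inj₂ (4F , _ , _))))) = refl
  encode-decode (inj₂ (inj₂ (inj₂ (inj₂ (5F , _ , _))))) = refl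
  encode-decode (inj₂ (inj₂ (inj₂ (inj₂ (6F , _ , _))))) = refl

  decode-encode : ∀ a → decode (encode a) ≡ a
  decode-encode (orig _)  = refl
  decode-encode (zv _)    = refl
  decode-encode (xv _)    = refl
  decode-encode (yv _)    = refl
  decode-encode (ev _ _)  = refl
  decode-encode (px₀ _ _) = refl
  decode-encode (px₁ _ _) = refl
  decode-encode (px₂ _ _) = refl
  decode-encode (py₀ _ _) = refl
  decode-encode (py₁ _ _) = refl
  decode-encode (py₂ _ _) = refl

  V'↔Fin : V' ↔ Fin (n + (n + (M + (M + 7 * (n * n)))))
  V'↔Fin = ↔-trans (mk↔ₛ′ encode decode encode-decode decode-encode) (↔-sym Fin↔Code)
    where
    Fin↔Code = ↔-trans +↔⊎ (↔-refl ⊎-↔ ↔-trans +↔⊎ (↔-refl ⊎-↔ ↔-trans +↔⊎ (↔-refl ⊎-↔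
               ↔-trans +↔⊎ (↔-refl ⊎-↔ ↔-trans *↔× (↔-refl ×-↔ *↔×)))))

  open FiniteSum V'↔Fin

  label : Fin n → Fin n → Fin M
  label u v = lab (c u) (c v)

  height : V' → ℕ
  height (xv _)    = 0
  height (px₀ _ _) = 1
  height (px₁ _ _) = 2
  height (px₂ _ _) = 3
  height (py₂ _ _) = 5
  height (py₁ _ _) = 6
  height (py₀ _ _) = 7
  height (yv _)    = 8
  height _         = 4

  y-load : Fin M → V' → ℕ
  y-load b (yv b′)    = δ b′ b
  y-load b (py₀ u v) = δ (label u v) b
  y-load b (py₁ u v) = δ (label u v) b
  y-load b (py₂ u v) = δ (label u v) b
  y-load b _         = 0

  on-Y : (V' → ℕ) → V' → ℕ
  on-Y w a = ∑[ b < M ] (indicator (a ≟ᴬ yv b) * w a)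

  on-Y-outside : ∀ w a → (∀ b → a ≢ yv b) → on-Y w a ≡ 0
  on-Y-outside w a a∉Y =
    trans (sum-cong-≗ (λ b → cong (_* w a) (indicator-no (a ≟ᴬ yv b) (a∉Y b)))) (sum-replicate-zero M)

  on-Y-yv : ∀ w b → on-Y w (yv b) ≡ w (yv b)
  on-Y-yv w b = begin
    ∑[ b′ < M ] (indicator (yv b ≟ᴬ yv b′) * w (yv b))
      ≡⟨ sum-cong-≗ (λ b′ → cong (_* w (yv b)) (indicator-⇔ yv-≡ (yv b ≟ᴬ yv b′) (b′ ≟ b))) ⟩
    ∑[ b′ < M ] (δ b′ b * w (yv b))
      ≡⟨ *-distribʳ-sum {M} (w (yv b)) (λ b′ → δ b′ b) ⟨
    (∑[ b′ < M ] δ b′ b) * w (yv b)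
      ≡⟨ cong (_* w (yv b)) (∑-δ b) ⟩
    1 * w (yv b)
      ≡⟨ *-identityˡ _ ⟩
    w (yv b) ∎
    where
    open ≡-Reasoning
    yv-≡ : ∀ {b′} → yv b ≡ yv b′ ⇔ b′ ≡ b
    yv-≡ = mk⇔ (λ { refl → refl }) (λ { refl → refl })

  T-weight-on : ∀ w → (∀ b → w (xv b) ≡ 0) → ∀ a → weight-on w T a ≡ on-Y w a + weight-on w S a
  T-weight-on w wX a@(orig _)  = sym (cong (_+ weight-on w S a) (on-Y-outside w a λ _ ()))
  T-weight-on w wX a@(zv _)    = sym (cong (_+ weight-on w S a) (on-Y-outside w a λ _ ()))
  T-weight-on w wX a@(xv b)    = sym (cong₂ _+_ (on-Y-outside w a λ _ ()) (wX b))
  T-weight-on w wX (yv b)      = sym (trans (+-identityʳ _) (on-Y-yv w b))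
  T-weight-on w wX a@(ev _ _)  = sym (cong (_+ weight-on w S a) (on-Y-outside w a λ _ ()))
  T-weight-on w wX a@(px₀ _ _) = sym (cong (_+ weight-on w S a) (on-Y-outside w a λ _ ()))
  T-weight-on w wX a@(px₁ _ _) = sym (cong (_+ weight-on w S a) (on-Y-outside w a λ _ ()))
  T-weight-on w wX a@(px₂ _ _) = sym (cong (_+ weight-on w S a) (on-Y-outside w a λ _ ()))
  T-weight-on w wX a@(py₀ _ _) = sym (cong (_+ weight-on w S a) (on-Y-outside w a λ _ ()))
  T-weight-on w wX a@(py₁ _ _) = sym (cong (_+ weight-on w S a) (on-Y-outside w a λ _ ()))
  T-weight-on w wX a@(py₂ _ _) = sym (cong (_+ weight-on w S a) (on-Y-outside w a λ _ ()))

  weight-T : ∀ w → (∀ b → w (xv b) ≡ 0) → weight w T ≡ ∑[ b < M ] w (yv b) + weight w S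
  weight-T w wX = begin
    weight w T
      ≡⟨ ∑ᴬ-cong (T-weight-on w wX) ⟩
    ∑ᴬ (λ a → on-Y w a + weight-on w S a)
      ≡⟨ ∑-distrib-+ (on-Y w ∘ from) (weight-on w S ∘ from) ⟩
    ∑ᴬ (on-Y w) + weight w S
      ≡⟨ cong (_+ weight w S) (∑-comm (λ i b → indicator (from i ≟ᴬ yv b) * w (from i))) ⟩
    ∑[ b < M ] ∑ᴬ (λ a → indicator (a ≟ᴬ yv b) * w a) + weight w S
      ≡⟨ cong (_+ weight w S) (sum-cong-≗ (λ b → ∑ᴬ-pick (yv b) w)) ⟩
    ∑[ b < M ] w (yv b) + weight w S ∎
    where
    open ≡-Reasoning
    open Inverse V'↔Fin using (from)

  slide-move : ∀ {I J} → ((u , v , _) : Slide I J) → TokenMove I u v J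
  slide-move (_ , _ , Iu , Iv , _ , moved , _) = Iu , Iv , moved

  ascent : ∀ {t I K} → (V' → ℕ) → Slides t I K → ℕ
  ascent w (done _)              = 0
  ascent w (step (u , v , _) s) = (w v ∸ w u) + ascent w s

  weight-≤-ascent : ∀ w {t I K} (s : Slides t I K) → weight w K ≤ weight w I + ascent w s
  weight-≤-ascent w {I = I} {K} (done I≗K) =
    ≤-reflexive (trans (sym (weight-cong w {I} {K} I≗K)) (sym (+-identityʳ _)))
  weight-≤-ascent w {I = I} {K} (step {J = J} sl@(u , v , _) s) = begin
    weight w K                                    ≤⟨ weight-≤-ascent w s ⟩
    weight w J + ascent w s                       ≤⟨ +-monoˡ-≤ (ascent w s) (weight-move-≤ w (slide-move sl)) ⟩
    weight w I + (w v ∸ w u) + ascent w s         ≡⟨ +-assoc (weight w I) _ _ ⟩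
    weight w I + ((w v ∸ w u) + ascent w s)       ∎
    where open ≤-Reasoning

  origin : V' → Maybe (Fin n)
  origin (orig u) = just u
  origin _        = nothing

  visits : Fin n → V' → ℕ
  visits u a = maybe′ (δ u) 0 (origin a)

  is-orig : V' → ℕ
  is-orig a = maybe′ (λ _ → 1) 0 (origin a)

  ∑-visits : ∀ a → ∑[ u < n ] visits u a ≡ is-orig a
  ∑-visits a with origin a
  ... | just v  = ∑-δ v
  ... | nothing = sum-replicate-zero n

  moves : ∀ {t I K} → Fin n → Slides t I K → ℕ
  moves u (done _)              = 0
  moves u (step (a , a′ , _) s) = (visits u a + visits u a′) + moves u s

  slide-cost : V' → V' → ℕ
  slide-cost a a′ = (height a′ ∸ height a) + (is-orig a + is-orig a′)

  arc-cost : ∀ {a a′} → Arc a a′ → slide-cost a a′ ≤ 1 × slide-cost a′ a ≤ 1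
  arc-cost (u-e _)    = s≤s z≤n , s≤s z≤n
  arc-cost (v-e _)    = s≤s z≤n , s≤s z≤n
  arc-cost (x-p₀ _ _) = s≤s z≤n , z≤n
  arc-cost (xp₀₁ _)   = s≤s z≤n , z≤n
  arc-cost (xp₁₂ _)   = s≤s z≤n , z≤n
  arc-cost (xp₂e _)   = s≤s z≤n , z≤n
  arc-cost (y-p₀ _ _) = z≤n , s≤s z≤n
  arc-cost (yp₀₁ _)   = z≤n , s≤s z≤n
  arc-cost (yp₁₂ _)   = z≤n , s≤s z≤n
  arc-cost (yp₂e _)   = z≤n , s≤s z≤n
  arc-cost v-z        = s≤s z≤n , s≤s z≤n

  adjacent-cost : ∀ {a a′} → Adj a a′ → slide-cost a a′ ≤ 1
  adjacent-cost (inj₁ arc) = proj₁ (arc-cost arc)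
  adjacent-cost (inj₂ arc) = proj₂ (arc-cost arc)

  ∑-visits-both : ∀ a a′ → ∑[ u < n ] (visits u a + visits u a′) ≡ is-orig a + is-orig a′
  ∑-visits-both a a′ =
    trans (∑-distrib-+ (λ u → visits u a) (λ u → visits u a′)) (cong₂ _+_ (∑-visits a) (∑-visits a′))

  budget : ∀ {t I K} (s : Slides t I K) → ascent height s + ∑[ u < n ] moves u s ≤ t
  budget (done _) = ≤-reflexive (sum-replicate-zero n)
  budget {suc t} (step (a , a′ , _ , _ , adj , _) s) = begin
    (rise + ascent height s) + ∑[ u < n ] (touches u + moves u s)
      ≡⟨ cong ((rise + ascent height s) +_) (∑-distrib-+ touches (λ u → moves u s)) ⟩
    (rise + ascent height s) + (∑[ u < n ] touches u + ∑[ u < n ] moves u s)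
      ≡⟨ interchange rise (ascent height s) _ _ ⟩
    (rise + ∑[ u < n ] touches u) + (ascent height s + ∑[ u < n ] moves u s)
      ≡⟨ cong (λ x → (rise + x) + (ascent height s + ∑[ u < n ] moves u s)) (∑-visits-both a a′) ⟩
    slide-cost a a′ + (ascent height s + ∑[ u < n ] moves u s)
      ≤⟨ +-mono-≤ (adjacent-cost adj) (budget s) ⟩
    suc t ∎
    where
    open ≤-Reasoning
    rise : ℕ
    rise = height a′ ∸ height a
    touches : Fin n → ℕ
    touches u = visits u a + visits u a′

  data Vacated (x : V') : ∀ {t I K} → Slides t I K → Set where
    here  : ∀ {t I K} {s : Slides t I K} → I x ≡ false → Vacated x s
    there : ∀ {t I J K} {sl : Slide I J} {s : Slides t J K} → Vacated x s → Vacated x (step sl s)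

  arrives : ∀ u {t I K} (s : Slides t I K) → I (orig u) ≡ false → K (orig u) ≡ true → 1 ≤ moves u s
  arrives u (done I≗K) Iu Ku = contradiction (trans (sym Ku) (trans (sym (I≗K (orig u))) Iu)) λ ()
  arrives u (step {J = J} sl@(a , a′ , _) s) Iu Ku with J (orig u) in Ju
  ... | false = ≤-trans (arrives u s Ju Ku) (m≤n+m _ _)
  ... | true with Move.arrived (slide-move sl) Iu Ju
  ...   | refl = ≤-trans (≤-reflexive (sym (δ-refl u))) (≤-trans (m≤n+m _ (visits u a)) (m≤m+n _ _))

  returns : ∀ u {t I K} (s : Slides t I K) → I (orig u) ≡ true → K (orig u) ≡ true →
            Vacated (orig u) s → 2 ≤ moves u s
  returns u s Iu Ku (here Iu′) = contradiction (trans (sym Iu) Iu′) λ ()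
  returns u (step {J = J} sl@(a , a′ , _) s) Iu Ku (there vacated) with J (orig u) in Ju
  ... | true = ≤-trans (returns u s Ju Ku vacated) (m≤n+m _ _)
  ... | false with Move.departed (slide-move sl) Iu Ju
  ...   | refl = +-mono-≤ (≤-trans (≤-reflexive (sym (δ-refl u))) (m≤m+n _ _)) (arrives u s Ju Ku)

  y-load-along-arc : ∀ b {a a′} → Arc a a′ →
    y-load b a ≡ y-load b a′ ⊎ ∃[ u ] ∃[ v ] a ≡ py₂ u v × a′ ≡ ev u v × Edge u v
  y-load-along-arc b (u-e _)       = inj₁ refl
  y-load-along-arc b (v-e _)       = inj₁ refl
  y-load-along-arc b (x-p₀ _ _)    = inj₁ refl
  y-load-along-arc b (xp₀₁ _)      = inj₁ refl
  y-load-along-arc b (xp₁₂ _)      = inj₁ refl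
  y-load-along-arc b (xp₂e _)      = inj₁ refl
  y-load-along-arc b (y-p₀ _ refl) = inj₁ refl
  y-load-along-arc b (yp₀₁ _)      = inj₁ refl
  y-load-along-arc b (yp₁₂ _)      = inj₁ refl
  y-load-along-arc b (yp₂e uv)     = inj₂ (_ , _ , refl , refl , uv)
  y-load-along-arc b v-z           = inj₁ refl

  y-load-along-edge : ∀ b {a a′} → Adj a a′ →
    y-load b a′ ≤ y-load b a ⊎ ∃[ u ] ∃[ v ] a ≡ ev u v × Edge u v × label u v ≡ b
  y-load-along-edge b (inj₁ arc) with y-load-along-arc b arc
  ... | inj₁ same                      = inj₁ (≤-reflexive (sym same))
  ... | inj₂ (_ , _ , refl , refl , _) = inj₁ z≤n
  y-load-along-edge b (inj₂ arc) with y-load-along-arc b arc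
  ... | inj₁ same                       = inj₁ (≤-reflexive same)
  ... | inj₂ (u , v , refl , refl , uv) with label u v ≟ b
  ...   | yes uv-labelled-b = inj₂ (u , v , refl , uv , uv-labelled-b)
  ...   | no _              = inj₁ z≤n

  VacatedEdge : ∀ {t I K} → Fin M → Slides t I K → Set
  VacatedEdge b s = ∃[ u ] ∃[ v ] Edge u v × label u v ≡ b × Vacated (orig u) s × Vacated (orig v) s

  vacated-later : ∀ {b t I J K} {sl : Slide I J} {s : Slides t J K} → VacatedEdge b s → VacatedEdge b (step sl s)
  vacated-later (u , v , uv , labelled , u-vacated , v-vacated) =
    u , v , uv , labelled , there u-vacated , there v-vacated

  -- A token can only enter the y-side of label b from some v_e of label b, and while v_e is
  -- occupied neither end of e is.
  enters-y-side : ∀ b {t I K} (s : Slides t I K) → Independent I → weight (y-load b) I < weight (y-load b) K →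
                  VacatedEdge b s
  enters-y-side b {I = I} {K} (done I≗K) _ rises =
    contradiction (weight-cong (y-load b) {I} {K} I≗K) (<⇒≢ rises)
  enters-y-side b {I = I} (step {J = J} sl@(a , _ , Ia , _ , adj , _ , J-independent) s) I-independent rises
    with y-load-along-edge b adj
  ... | inj₂ (u , v , refl , uv , labelled) =
        u , v , uv , labelled , here (vacant (u-e uv)) , here (vacant (v-e uv))
    where
    vacant : ∀ {x} → Arc x a → I x ≡ false
    vacant arc = ¬-not λ Ix → I-independent _ a Ix Ia (inj₁ arc)
  ... | inj₁ no-rise = vacated-later (enters-y-side b s J-independent (≤-<-trans stalls rises))
    where
    stalls : weight (y-load b) J ≤ weight (y-load b) I
    stalls = weight-move-downhill (y-load b) (slide-move sl) no-rise

  S-misses-an-end : ∀ {a a′} → Arc a a′ → S a ≡ false ⊎ S a′ ≡ false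
  S-misses-an-end (u-e _)    = inj₂ refl
  S-misses-an-end (v-e _)    = inj₂ refl
  S-misses-an-end (x-p₀ _ _) = inj₂ refl
  S-misses-an-end (xp₀₁ _)   = inj₁ refl
  S-misses-an-end (xp₁₂ _)   = inj₂ refl
  S-misses-an-end (xp₂e _)   = inj₁ refl
  S-misses-an-end (y-p₀ _ _) = inj₂ refl
  S-misses-an-end (yp₀₁ _)   = inj₁ refl
  S-misses-an-end (yp₁₂ _)   = inj₂ refl
  S-misses-an-end (yp₂e _)   = inj₁ refl
  S-misses-an-end v-z        = inj₂ refl

  S-independent : Independent S
  S-independent a a′ Sa Sa′ (inj₁ arc) with S-misses-an-end arc
  ... | inj₁ Sa≡false  = contradiction (trans (sym Sa) Sa≡false) λ ()
  ... | inj₂ Sa′≡false = contradiction (trans (sym Sa′) Sa′≡false) λ ()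
  S-independent a a′ Sa Sa′ (inj₂ arc) with S-misses-an-end arc
  ... | inj₁ Sa′≡false = contradiction (trans (sym Sa′) Sa′≡false) λ ()
  ... | inj₂ Sa≡false  = contradiction (trans (sym Sa) Sa≡false) λ ()

  height-T : weight height T ≡ 8 * M + weight height S
  height-T = trans (weight-T height (λ _ → refl))
                   (cong (_+ weight height S) (trans (∑-const M 8) (*-comm M 8)))

  y-load-rises : ∀ b → weight (y-load b) S < weight (y-load b) T
  y-load-rises b = ≤-reflexive (sym (trans (weight-T (y-load b) (λ _ → refl))
                                           (cong (_+ weight (y-load b) S) (∑-δ b))))

  module _ {t} (s : Slides t S T) where

    heavy-edge : ∀ b → ∃[ u ] ∃[ v ] _~_ G u v × label u v ≡ b × 2 ≤ moves u s × 2 ≤ moves v s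
    heavy-edge b = heavy (enters-y-side b s S-independent (y-load-rises b))
      where
      heavy : VacatedEdge b s → ∃[ u ] ∃[ v ] _~_ G u v × label u v ≡ b × 2 ≤ moves u s × 2 ≤ moves v s
      heavy (u , v , (_ , uv) , labelled , u-vacated , v-vacated) =
        u , v , uv , labelled , returns u s refl refl u-vacated , returns v s refl refl v-vacated

    ascent≥8m : 8 * M ≤ ascent height s
    ascent≥8m = +-cancelʳ-≤ (weight height S) _ _ (begin
      8 * M + weight height S             ≡⟨ height-T ⟨
      weight height T                     ≤⟨ weight-≤-ascent height s ⟩
      weight height S + ascent height s   ≡⟨ +-comm (weight height S) _ ⟩
      ascent height s + weight height S   ∎)
      where open ≤-Reasoning

    few-heavy : t ≤ ℓ k → ∑[ u < n ] indicator (2 ≤? moves u s) ≤ k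
    few-heavy t≤ℓ = *-cancelˡ-≤ 2 (≤-trans (markov 2 (λ u → moves u s)) moves≤2k)
      where
      open ≤-Reasoning
      moves≤2k : ∑[ u < n ] moves u s ≤ 2 * k
      moves≤2k = +-cancelˡ-≤ (8 * M) _ _ (begin
        8 * M + ∑[ u < n ] moves u s               ≤⟨ +-monoˡ-≤ _ ascent≥8m ⟩
        ascent height s + ∑[ u < n ] moves u s     ≤⟨ budget s ⟩
        t                                          ≤⟨ t≤ℓ ⟩
        8 * M + 2 * k                              ∎)

lemma5p3 : ∀ {n k} (G : SimpleGraph n) (c : Fin n → Fin k) →
    NoEdgeInsideClass G c →
    (lab : Fin k → Fin k → Fin (m k)) → IsPairLabelling lab →
    (t : ℕ) → t ≤ ℓ k →
    Construction.Slides G c lab t (Construction.S G c lab) (Construction.T G c lab) →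
    MulticoloredClique G c
lemma5p3 G c no-edge-inside lab labelling t t≤ℓ s =
  multicolored-clique G c lab no-edge-inside labelling (heavy-edge s) (λ u → 2 ≤? moves u s) (few-heavy s t≤ℓ)
  where open Reconfiguration G c lab
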